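{- Define sets $S_n$ of integers as follows: $S_1=A_3^*$, and for $n\ge2$, $S_n$ is the set of positive integers $m$ such that for every prime $p$ dividing $m$, the exponent of $p$ in the prime factorization of $m$ lies in $S_{n-1}$. Then for each $n$, $S_n$ has lower uniform density $0$.
   Context: $A_3^*=\{0,1,3,4,9,10,\dots\}$ is the greedy set of nonnegative integers free of three-term arithmetic progressions, equivalently the set of nonnegative integers with no digit $2$ in their base-$3$ expansion. For $A\subseteq\mathbb{N}$, the lower uniform density is $\underline{u}(A)=\lim_{s\to\infty}\min_{n\ge0}\frac1s\#\{a\in A:n<a\le n+s\}$. -}

module Defs where

open import Data.Nat using (ℕ; zero; suc; _+_; _*_; _^_; _<_; _≤_)
open import Data.Nat.DivMod using (_/_; _%_)
open import Data.Nat.Divisibility using (_∣_)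
open import Data.Nat.Primality using (Prime)
open import Data.Empty using (⊥)
open import Data.Product using (_×_; ∃-syntax)
open import Data.List using (List; length)
open import Data.List.Membership.Propositional using (_∈_)
open import Relation.Binary.PropositionalEquality using (_≢_)
open import Relation.Nullary using (¬_)

div3^ : ℕ → ℕ → ℕ
div3^ zero    m = m
div3^ (suc i) m = div3^ i m / 3

digit3 : ℕ → ℕ → ℕ
digit3 i m = div3^ i m % 3

A3* : ℕ → Set
A3* m = ∀ i → digit3 i m ≢ 2

-- InS n m  means  m ∈ S_n  (for n ≥ 1; S_0 is not defined in the paper, taken empty)
-- S_1 = A_3^*;  S_n (n ≥ 2) = positive m such that for every prime p ∣ m,
-- the exponent e of p in m (p^e ∣ m, p^(e+1) ∤ m) lies in S_{n-1}.
InS : ℕ → ℕ → Set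
InS zero          m = ⊥
InS (suc zero)    m = A3* m
InS (suc (suc n)) m =
  0 < m × (∀ p → Prime p → p ∣ m → ∀ e → p ^ e ∣ m → ¬ (p ^ suc e ∣ m) → InS (suc n) e)

-- "#{a ∈ A : n < a ≤ n+s} ≤ c" expressed as: some list of length c covers them.
CountAtMost : (ℕ → Set) → ℕ → ℕ → ℕ → Set
CountAtMost A n s c =
  ∃[ L ] (length L ≤ c × (∀ a → n < a → a ≤ n + s → A a → a ∈ L))

-- Lower uniform density of A equals 0:
-- lim_{s→∞} min_n (1/s)#{a ∈ A : n < a ≤ n+s} = 0, i.e. for every k ≥ 1 there
-- is S such that for all s ≥ S some window of length s has fewer than s/k elements.
LowerUniformDensityZero : (ℕ → Set) → Set
LowerUniformDensityZero A =
  ∀ k → 0 < k → ∃[ S ] (∀ s → S ≤ s → ∃[ n ] ∃[ c ] (CountAtMost A n s c × k * c < s))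

-- Every S_n has arbitrarily long gaps, which forces lower uniform density 0.
-- For A₃* the integers 2·3ˢ < a ≤ 2·3ˢ + s all have base-3 digit 2 at 3ˢ.
-- For n ≥ 2 fix an exponent e ≥ 1 outside S_{n-1}; a tower of 2s works, since
-- 2^(tower k) has 2-adic exponent tower k ∉ S_{k+1}. By the Chinese remainder
-- theorem s consecutive integers can each be made exactly divisible by p^e for
-- some prime p, so none of them lies in S_n. The moduli are added one at a time:
-- if p is a prime factor of M + 1 then M is invertible modulo p^(e+1), because
-- (1 + M)^(e+1) = 1 + M·u is divisible by p^(e+1).
module Submission where

open import Defs
open import Data.Nat
open import Data.Nat.Properties
open import Data.Nat.DivMod
open import Data.Nat.Divisibility
open import Data.Nat.Primality
open import Data.Nat.Primality.Factorisation using (factorise)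
open import Data.Nat.Solver using (module +-*-Solver)
open import Data.List using ([]; _∷_)
open import Data.List.Relation.Unary.All using (_∷_)
open import Data.Product
open import Data.Sum using (inj₁; inj₂)
open import Data.Empty using (⊥-elim)
open import Relation.Nullary using (¬_; contradiction)
open import Relation.Binary.PropositionalEquality
open +-*-Solver using (solve; _:+_; _:*_; _:=_; con)

Window : (ℕ → Set) → ℕ → ℕ → Set
Window P n s = ∀ j → j < s → P (n + suc j)

window-∈ : ∀ {P n s} → Window P n s → ∀ a → n < a → a ≤ n + s → P a
window-∈ {P} {n} {s} w a n<a a≤n+s with m≤n⇒∃[o]m+o≡n n<a
... | k , refl = subst P (+-suc n k) (w k (+-cancelˡ-< n k s a≤n+s))

gaps⇒lowerUniformDensityZero : ∀ {A} → (∀ s → ∃[ n ] Window (λ a → ¬ A a) n s) →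
                               LowerUniformDensityZero A
gaps⇒lowerUniformDensityZero {A} gap k _ = 1 , λ s 1≤s →
  let (n , empty) = gap s in
  n , 0 ,
  ([] , z≤n , λ a n<a a≤n+s Aa → ⊥-elim (window-∈ {λ a → ¬ A a} empty a n<a a≤n+s Aa)) ,
  subst (_< s) (sym (*-zeroʳ k)) 1≤s

div3^-suc : ∀ i m → div3^ (suc i) m ≡ div3^ i (m / 3)
div3^-suc zero    m = refl
div3^-suc (suc i) m = cong (_/ 3) (div3^-suc i m)

div3^[q*3^i+r]≡q : ∀ i q r → r < 3 ^ i → div3^ i (q * 3 ^ i + r) ≡ q
div3^[q*3^i+r]≡q zero    q .0 (s≤s z≤n) = trans (+-identityʳ (q * 1)) (*-identityʳ q)
div3^[q*3^i+r]≡q (suc i) q r r<3^[1+i] = begin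
  div3^ (suc i) (q * 3 ^ suc i + r)   ≡⟨ div3^-suc i _ ⟩
  div3^ i ((q * 3 ^ suc i + r) / 3)   ≡⟨ cong (λ x → div3^ i (x / 3)) (cong (_+ r) q*3^[1+i]≡) ⟩
  div3^ i ((q * 3 ^ i * 3 + r) / 3)   ≡⟨ cong (div3^ i) (+-distrib-/-∣ˡ r (n∣m*n (q * 3 ^ i))) ⟩
  div3^ i (q * 3 ^ i * 3 / 3 + r / 3) ≡⟨ cong (λ x → div3^ i (x + r / 3)) (m*n/n≡m (q * 3 ^ i) 3) ⟩
  div3^ i (q * 3 ^ i + r / 3)         ≡⟨ div3^[q*3^i+r]≡q i q (r / 3) r/3<3^i ⟩
  q                                   ∎
  where
  open ≡-Reasoning
  q*3^[1+i]≡ : q * 3 ^ suc i ≡ q * 3 ^ i * 3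
  q*3^[1+i]≡ = trans (cong (q *_) (*-comm 3 (3 ^ i))) (sym (*-assoc q (3 ^ i) 3))
  r/3<3^i : r / 3 < 3 ^ i
  r/3<3^i = m<n*o⇒m/o<n (subst (r <_) (*-comm 3 (3 ^ i)) r<3^[1+i])

n<3^n : ∀ n → n < 3 ^ n
n<3^n zero    = z<s
n<3^n (suc n) = begin-strict
  suc n          ≤⟨ n<3^n n ⟩
  3 ^ n          <⟨ m<m*n (3 ^ n) 3 {{m^n≢0 3 n}} (s≤s (s≤s z≤n)) ⟩
  3 ^ n * 3      ≡⟨ *-comm (3 ^ n) 3 ⟩
  3 ^ suc n      ∎
  where open ≤-Reasoning

digit3≡2-window : ∀ s → Window (λ a → digit3 s a ≡ 2) (2 * 3 ^ s) s
digit3≡2-window s j j<s =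
  cong (_% 3) (div3^[q*3^i+r]≡q s 2 (suc j) (<-≤-trans (s≤s j<s) (n<3^n s)))

A3*-gaps : ∀ s → ∃[ n ] Window (λ a → ¬ A3* a) n s
A3*-gaps s = 2 * 3 ^ s , λ j j<s noTwo → noTwo s (digit3≡2-window s j j<s)

ExactPower : ℕ → ℕ → ℕ → Set
ExactPower p e x = p ^ e ∣ x × ¬ (p ^ suc e ∣ x)

prime>1 : ∀ {p} → Prime p → 1 < p
prime>1 {p} pp = nonTrivial⇒n>1 p {{prime⇒nonTrivial pp}}

p^e<p^[1+e] : ∀ {p} → Prime p → ∀ e → p ^ e < p ^ suc e
p^e<p^[1+e] {p} pp e = subst (p ^ e <_) (*-comm (p ^ e) p)
  (m<m*n (p ^ e) p {{m^n≢0 p e {{prime⇒nonZero pp}}}} (prime>1 pp))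

exactPower-^ : ∀ {p} → Prime p → ∀ e → ExactPower p e (p ^ e)
exactPower-^ {p} pp e = ∣-refl , λ p^[1+e]∣p^e →
  <⇒≱ (p^e<p^[1+e] pp e) (∣⇒≤ {{m^n≢0 p e {{prime⇒nonZero pp}}}} p^[1+e]∣p^e)

exactPower⇒∣ : ∀ {p e x} → 1 ≤ e → ExactPower p e x → p ∣ x
exactPower⇒∣ {p} {suc e} _ (p^[1+e]∣x , _) = ∣-trans (m∣m*n (p ^ e)) p^[1+e]∣x

exactPower-+ : ∀ {p e x y} → ExactPower p e x → p ^ suc e ∣ y → ExactPower p e (x + y)
exactPower-+ {p} {e} {x} {y} (p^e∣x , p^[1+e]∤x) p^[1+e]∣y =
  ∣m∣n⇒∣m+n p^e∣x (∣-trans (n∣m*n p) p^[1+e]∣y) ,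
  λ p^[1+e]∣x+y →
    p^[1+e]∤x (∣m+n∣m⇒∣n (subst (p ^ suc e ∣_) (+-comm x y) p^[1+e]∣x+y) p^[1+e]∣y)

-- The hypothesis says x ≡ p ^ e (mod p ^ suc e), phrased without subtracting from x.
exactPower-residue : ∀ {p e x} → Prime p →
                     p ^ suc e ∣ (p ^ suc e ∸ p ^ e) + x → ExactPower p e x
exactPower-residue {p} {e} {x} pp q∣r+x = P∣x , q∤x
  where
  P = p ^ e
  q = p ^ suc e
  r = q ∸ P
  P<q : P < q
  P<q = p^e<p^[1+e] pp e
  P∣r : P ∣ r
  P∣r = ∣m+n∣m⇒∣n (subst (P ∣_) (sym (m+[n∸m]≡n (<⇒≤ P<q))) (n∣m*n p)) ∣-refl
  P∣x : P ∣ x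
  P∣x = ∣m+n∣m⇒∣n (∣-trans (n∣m*n p) q∣r+x) P∣r
  q∤x : ¬ q ∣ x
  q∤x q∣x = <⇒≱ r<q (∣⇒≤ {{>-nonZero (m<n⇒0<n∸m P<q)}} q∣r)
    where
    q∣r : q ∣ r
    q∣r = ∣m+n∣m⇒∣n (subst (q ∣_) (+-comm r x) q∣r+x) q∣x
    r<q : r < q
    r<q = ∸-monoʳ-< (m^n>0 p {{prime⇒nonZero pp}} e) (<⇒≤ P<q)

∃[u][1+m]^k≡1+m*u : ∀ m k → ∃[ u ] (1 + m) ^ k ≡ 1 + m * u
∃[u][1+m]^k≡1+m*u m zero    = 0 , cong suc (sym (*-zeroʳ m))
∃[u][1+m]^k≡1+m*u m (suc k) =
  let (u , eq) = ∃[u][1+m]^k≡1+m*u m k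
      y = (1 + m) ^ k
  in u + y , (begin
    y + m * y           ≡⟨ cong (_+ m * y) eq ⟩
    1 + m * u + m * y   ≡⟨ cong suc (sym (*-distribˡ-+ m u y)) ⟩
    1 + m * (u + y)     ∎)
  where open ≡-Reasoning

^-monoˡ-∣ : ∀ {m n} k → m ∣ n → m ^ k ∣ n ^ k
^-monoˡ-∣ zero    m∣n = ∣-refl
^-monoˡ-∣ (suc k) m∣n = *-pres-∣ m∣n (^-monoˡ-∣ k m∣n)

∣1+m⇒∃[t]p^k∣x+m*t : ∀ {p m} k → p ∣ 1 + m → ∀ x → ∃[ t ] p ^ k ∣ x + m * t
∣1+m⇒∃[t]p^k∣x+m*t {p} {m} k p∣1+m x =
  let (u , eq) = ∃[u][1+m]^k≡1+m*u m k in
  u * x , subst (p ^ k ∣_) (factor u) (∣m⇒∣m*n x (subst (p ^ k ∣_) eq (^-monoˡ-∣ k p∣1+m)))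
  where
  factor : ∀ u → (1 + m * u) * x ≡ x + m * (u * x)
  factor u = solve 3 (λ m u x → (con 1 :+ m :* u) :* x := x :+ m :* (u :* x)) refl m u x

∃-prime-divisor : ∀ {n} → 1 < n → ∃[ p ] Prime p × p ∣ n
∃-prime-divisor {n@(suc _)} 1<n with factorise n
... | record { factors = [] ; isFactorisation = n≡1 } = contradiction n≡1 (>⇒≢ 1<n)
... | record { factors = p ∷ ps ; isFactorisation = n≡p*ps ; factorsPrime = pp ∷ _ } =
  p , pp , subst (p ∣_) (sym n≡p*ps) (m∣m*n _)

-- Recording p ^ suc e ∣ M keeps the witness valid after shifting a by any multiple of M.
ExactPrimePower : ℕ → ℕ → ℕ → Set
ExactPrimePower e M a = ∃[ p ] Prime p × p ^ suc e ∣ M × ExactPower p e a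

window-extend : ∀ {e M n s p t} → Window (ExactPrimePower e M) n s → Prime p →
                p ^ suc e ∣ (p ^ suc e ∸ p ^ e) + (n + suc s) + M * t →
                Window (ExactPrimePower e (M * p ^ suc e)) (n + M * t) (suc s)
window-extend {e} {M} {n} {s} {p} {t} window pp q∣residue j j<1+s
  with m<1+n⇒m<n∨m≡n j<1+s
... | inj₁ j<s =
  let (p′ , pp′ , p′^[1+e]∣M , exact) = window j j<s in
  p′ , pp′ , ∣m⇒∣m*n (p ^ suc e) p′^[1+e]∣M ,
  subst (ExactPower p′ e) (shift-comm n (M * t) (suc j))
        (exactPower-+ {p′} {e} exact (∣m⇒∣m*n t p′^[1+e]∣M))
  where
  shift-comm : ∀ n m j → n + j + m ≡ n + m + j
  shift-comm = solve 3 (λ n m j → n :+ j :+ m := n :+ m :+ j) refl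
... | inj₂ refl =
  p , pp , n∣m*n M ,
  exactPower-residue {p} {e} pp
    (subst (p ^ suc e ∣_) (reassociate (p ^ suc e ∸ p ^ e) n (M * t) (suc s)) q∣residue)
  where
  reassociate : ∀ r n m j → r + (n + j) + m ≡ r + (n + m + j)
  reassociate = solve 4 (λ r n m j → r :+ (n :+ j) :+ m := r :+ (n :+ m :+ j)) refl

exactPrimePowerWindow : ∀ e s → ∃[ M ] ∃[ n ] 0 < M × Window (ExactPrimePower e M) n s
exactPrimePowerWindow e zero    = 1 , 0 , z<s , λ _ ()
exactPrimePowerWindow e (suc s) with exactPrimePowerWindow e s
... | M , n , 0<M , window with ∃-prime-divisor (s≤s 0<M)
... | p , pp , p∣1+M
  with ∣1+m⇒∃[t]p^k∣x+m*t (suc e) p∣1+M ((p ^ suc e ∸ p ^ e) + (n + suc s))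
... | t , q∣residue =
  M * p ^ suc e , n + M * t , *-mono-≤ 0<M (m^n>0 p {{prime⇒nonZero pp}} (suc e)) ,
  window-extend {e} window pp q∣residue

tower : ℕ → ℕ
tower zero    = 2
tower (suc k) = 2 ^ tower k

1≤tower : ∀ k → 1 ≤ tower k
1≤tower zero    = s≤s z≤n
1≤tower (suc k) = m^n>0 2 (tower k)

InS-exponent : ∀ {k a p e} → InS (2 + k) a → Prime p → 1 ≤ e → ExactPower p e a →
               InS (1 + k) e
InS-exponent (_ , exponents∈S) pp 1≤e exact@(p^e∣a , p^[1+e]∤a) =
  exponents∈S _ pp (exactPower⇒∣ 1≤e exact) _ p^e∣a p^[1+e]∤a

tower∉S : ∀ k → ¬ InS (1 + k) (tower k)
tower∉S zero    A3*[2] = A3*[2] 0 refl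
tower∉S (suc k) 2^t∈S =
  tower∉S k (InS-exponent 2^t∈S prime[2] (1≤tower k) (exactPower-^ prime[2] (tower k)))

S-gaps : ∀ k s → ∃[ n ] Window (λ a → ¬ InS (2 + k) a) n s
S-gaps k s =
  let (_ , n , _ , window) = exactPrimePowerWindow (tower k) s in
  n , λ j j<s a∈S →
    let (p , pp , _ , exact) = window j j<s in
    tower∉S k (InS-exponent a∈S pp (1≤tower k) exact)

mainTheorem9 : ∀ (n : ℕ) → 1 ≤ n → LowerUniformDensityZero (InS n)
mainTheorem9 (suc zero)    _ = gaps⇒lowerUniformDensityZero A3*-gaps
mainTheorem9 (suc (suc k)) _ = gaps⇒lowerUniformDensityZero (S-gaps k)
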